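{- Let $\mathsf{T}:\mathsf{Krip}\to\mathsf{Pos}$ be a functor, $\Lambda$ a set of predicate liftings for $\mathsf{T}$, $\mathrm{Ax}$ a set of sound rank-1 axioms, $\mathcal{X}$ an $(\mathsf{i},\mathsf{T})$-dialgebra and $\phi\in\mathcal{L}(\Lambda)$. Then $\mathcal{X}\Vdash\phi$ if and only if $\mathcal{X}^+\models\phi$.
   Context: $\mathsf{Krip}$: posets and p-morphisms; $\mathsf{Pos}$: posets and order-preserving maps. An $(\mathsf{i},\mathsf{T})$-dialgebra is $(X,\le,\gamma)$ with $\gamma:(X,\le)\to\mathsf{T}(X,\le)$ order-preserving. An $n$-ary predicate lifting is a family $\lambda_{(X,\le)}:\mathrm{Up}(X,\le)^n\to\mathrm{Up}(\mathsf{T}(X,\le))$ (upsets) with $\lambda(f^{ -1}a_1,\dots)=(\mathsf{T}f)^{ -1}\lambda(a_1,\dots)$ for p-morphisms $f$. $\mathcal{L}(\Lambda)$: intuitionistic propositional formulas over a countably infinite set $\mathrm{Prop}$ closed under $\heartsuit^\lambda(\phi_1,\dots,\phi_n)$; under a valuation into upsets, connectives are intuitionistic and $x\Vdash\heartsuit^\lambda(\vec\phi)$ iff $\gamma(x)\in\lambda_{(X,\le)}([\![\vec\phi]\!])$; $\mathcal{X}\Vdash\phi$ if $\phi$ holds everywhere under every valuation. Rank-1 axiom: $\phi\leftrightarrow\psi$ with both sides implication-free and each letter in the scope of exactly one modality; sound if valid on all $(\mathsf{i},\mathsf{T})$-dialgebras. For a Heyting algebra $A$, $\mathsf{L}A$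 is the distributive lattice freely generated by $\dot\heartsuit^\lambda(a_1,\dots,a_n)$ ($a_i\in A$) modulo the instances (letters replaced by elements of $A$, $\leftrightarrow$ by $=$) of $\mathrm{Ax}$. An $(\mathsf{L},\mathsf{j})$-dialgebra is $(A,\alpha)$ with $A$ Heyting and $\alpha:\mathsf{L}A\to A$ a lattice homomorphism; formulas are evaluated under an assignment $\mathrm{Prop}\to A$ with connectives as Heyting operations and $\heartsuit^\lambda(\phi_1,\dots)$ as $\alpha(\dot\heartsuit^\lambda(v(\phi_1),\dots))$; $(A,\alpha)\models\phi$ if $\phi$ evaluates to the top element under every assignment. The complex algebra of $\mathcal{X}=(X,\le,\gamma)$ is $\mathcal{X}^+=(\mathrm{Up}(X,\le),\gamma^{ -1}\circ\rho_{(X,\le)})$ where $\mathrm{Up}(X,\le)$ is the Heyting algebra of upsets and $\rho_{(X,\le)}:\mathsf{L}(\mathrm{Up}(X,\le))\to\mathrm{Up}(\mathsf{T}(X,\le))$ is the lattice homomorphism with $\dot\heartsuit^\lambda(a_1,\dots,a_n)\mapsto\lambda_{(X,\le)}(a_1,\dots,a_n)$. -}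

module Defs where

open import Level using (0ℓ; Level) renaming (suc to lsuc; _⊔_ to _⊔ˡ_)
open import Data.Nat using (ℕ)
open import Data.Fin using (Fin)
open import Data.Product using (Σ; ∃; _×_; _,_; proj₁; proj₂)
open import Data.Sum using (_⊎_; inj₁; inj₂; [_,_])
open import Data.Unit using () renaming (⊤ to 𝟙; tt to ⋆)
open import Data.Empty using () renaming (⊥ to 𝟘; ⊥-elim to 𝟘-elim)
open import Function using (_∘_; id)
open import Relation.Binary.Bundles using (Poset)
open import Relation.Binary.Morphism.Bundles using (PosetHomomorphism; mkPosetHomo)
open import Relation.Binary.Lattice.Bundles using (HeytingAlgebra)

-- Posets (objects of Krip and Pos).  Size convention: small posets.

Pos₀ : Set₁
Pos₀ = Poset 0ℓ 0ℓ 0ℓ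

Mono : Pos₀ → Pos₀ → Set
Mono X Y = PosetHomomorphism X Y

app : ∀ {X Y} → Mono X Y → Poset.Carrier X → Poset.Carrier Y
app f = PosetHomomorphism.⟦_⟧ f

record PMorphism (X Y : Pos₀) : Set where
  private
    module X = Poset X
    module Y = Poset Y
  field
    hom  : Mono X Y
    back : ∀ x y → app hom x Y.≤ y →
           Σ X.Carrier λ x' → (x X.≤ x') × (app hom x' Y.≈ y)
open PMorphism public

idP : (X : Pos₀) → PMorphism X X
idP X = record
  { hom  = mkPosetHomo X X id id
  ; back = λ x y x≤y → y , x≤y , Poset.Eq.refl X }

_∘P_ : ∀ {X Y Z} → PMorphism Y Z → PMorphism X Y → PMorphism X Z
_∘P_ {X} {Y} {Z} f g = record
  { hom  = mkPosetHomo X Z (app (hom f) ∘ app (hom g))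
                            (PosetHomomorphism.mono (hom f) ∘ PosetHomomorphism.mono (hom g))
  ; back = λ x z fgx≤z →
      let (u , gx≤u , fu≈z) = back f (app (hom g) x) z fgx≤z
          (x' , x≤x' , gx'≈u) = back g x u gx≤u
      in x' , x≤x' , Poset.Eq.trans Z (PosetHomomorphism.cong (hom f) gx'≈u) fu≈z }

-- Functors T : Krip → Pos (functor laws up to the equality of the posets)

record KripToPos : Set₁ where
  field
    obj    : Pos₀ → Pos₀
    map    : ∀ {X Y} → PMorphism X Y → Mono (obj X) (obj Y)
    map-cong : ∀ {X Y} (f g : PMorphism X Y) →
               (∀ x → Poset._≈_ Y (app (hom f) x) (app (hom g) x)) →
               ∀ t → Poset._≈_ (obj Y) (app (map f) t) (app (map g) t)
    map-id : ∀ {X} t → Poset._≈_ (obj X) (app (map (idP X)) t) t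
    map-∘  : ∀ {X Y Z} (f : PMorphism Y Z) (g : PMorphism X Y) t →
             Poset._≈_ (obj Z) (app (map (f ∘P g)) t) (app (map f) (app (map g) t))
open KripToPos public

record Up (X : Pos₀) : Set₁ where
  field
    mem : Poset.Carrier X → Set
    up  : ∀ {x y} → Poset._≤_ X x y → mem x → mem y
open Up public

_⊆ᵘ_ : ∀ {X} → Up X → Up X → Set
_⊆ᵘ_ {X} a b = ∀ x → mem a x → mem b x

_≐_ : ∀ {X} → Up X → Up X → Set
a ≐ b = (a ⊆ᵘ b) × (b ⊆ᵘ a)

_⁻¹[_] : ∀ {X Y} → Mono X Y → Up Y → Up X
f ⁻¹[ a ] = record { mem = mem a ∘ app f ; up = λ x≤y → up a (PosetHomomorphism.mono f x≤y) }

module _ {X : Pos₀} where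
  open Poset X

  ⊤ᵘ : Up X
  ⊤ᵘ = record { mem = λ _ → 𝟙 ; up = λ _ _ → ⋆ }

  ⊥ᵘ : Up X
  ⊥ᵘ = record { mem = λ _ → 𝟘 ; up = λ _ () }

  _∩ᵘ_ : Up X → Up X → Up X
  a ∩ᵘ b = record { mem = λ x → mem a x × mem b x
                  ; up = λ x≤y p → up a x≤y (proj₁ p) , up b x≤y (proj₂ p) }

  _∪ᵘ_ : Up X → Up X → Up X
  a ∪ᵘ b = record { mem = λ x → mem a x ⊎ mem b x
                  ; up = λ x≤y → [ inj₁ ∘ up a x≤y , inj₂ ∘ up b x≤y ] }

  _⇒ᵘ_ : Up X → Up X → Up X
  a ⇒ᵘ b = record { mem = λ x → ∀ y → x ≤ y → mem a y → mem b y
                  ; up = λ x≤y h z y≤z → h z (trans x≤y y≤z) }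

UpHA : Pos₀ → HeytingAlgebra (lsuc 0ℓ) 0ℓ 0ℓ
UpHA X = record
  { Carrier = Up X ; _≈_ = _≐_ ; _≤_ = _⊆ᵘ_
  ; _∨_ = _∪ᵘ_ ; _∧_ = _∩ᵘ_ ; _⇨_ = _⇒ᵘ_ ; ⊤ = ⊤ᵘ ; ⊥ = ⊥ᵘ
  ; isHeytingAlgebra = record
    { isBoundedLattice = record
      { isLattice = record
        { isPartialOrder = record
          { isPreorder = record
            { isEquivalence = record
              { refl = (λ _ p → p) , (λ _ p → p)
              ; sym = λ { (f , g) → g , f }
              ; trans = λ { (f , g) (h , k) → (λ x → h x ∘ f x) , (λ x → g x ∘ k x) } }
            ; reflexive = proj₁
            ; trans = λ f g x → g x ∘ f x }
          ; antisym = _,_ }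
        ; supremum = λ a b → (λ _ → inj₁) , (λ _ → inj₂) , λ c f g x → [ f x , g x ]
        ; infimum = λ a b → (λ _ → proj₁) , (λ _ → proj₂) , λ c f g x p → f x p , g x p }
      ; maximum = λ a _ _ → ⋆
      ; minimum = λ a _ () }
    ; exponential = λ w a b →
        (λ h x wx y x≤y ay → h y (up w x≤y wx , ay))
      , (λ h x p → h x (proj₁ p) x (Poset.refl X) (proj₂ p)) } }

record PredLifting (T : KripToPos) (n : ℕ) : Set₁ where
  field
    lift    : ∀ X → (Fin n → Up X) → Up (obj T X)
    -- λ_X is a function on upsets (respects extensional equality)
    lift-cong : ∀ X (as bs : Fin n → Up X) → (∀ i → as i ≐ bs i) → lift X as ≐ lift X bs
    natural : ∀ {X Y} (f : PMorphism X Y) (as : Fin n → Up Y) →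
              lift X (λ i → hom f ⁻¹[ as i ]) ≐ (map T f ⁻¹[ lift Y as ])
open PredLifting public

record Liftings (T : KripToPos) : Set₁ where
  field
    Idx : Set
    ar  : Idx → ℕ
    liftingOf : (l : Idx) → PredLifting T (ar l)
open Liftings public

module Language {T : KripToPos} (Λ : Liftings T) where

  infixr 6 _∧f_
  infixr 5 _∨f_
  infixr 4 _⇒f_ _⇔f_

  data Form : Set where
    var  : ℕ → Form
    ⊤f   : Form
    ⊥f   : Form
    _∧f_ : Form → Form → Form
    _∨f_ : Form → Form → Form
    _⇒f_ : Form → Form → Form
    ♡    : (l : Idx Λ) → (Fin (ar Λ l) → Form) → Form

  _⇔f_ : Form → Form → Form
  φ ⇔f ψ = (φ ⇒f ψ) ∧f (ψ ⇒f φ)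

  record Dialgebra : Set₁ where
    field
      X : Pos₀
      γ : Mono X (obj T X)
  open Dialgebra public

  Valuation : Pos₀ → Set₁
  Valuation X = ℕ → Up X

  ⟦_⟧ : (𝒳 : Dialgebra) → Valuation (X 𝒳) → Form → Up (X 𝒳)
  ⟦ 𝒳 ⟧ V (var p)   = V p
  ⟦ 𝒳 ⟧ V ⊤f        = ⊤ᵘ
  ⟦ 𝒳 ⟧ V ⊥f        = ⊥ᵘ
  ⟦ 𝒳 ⟧ V (φ ∧f ψ)  = ⟦ 𝒳 ⟧ V φ ∩ᵘ ⟦ 𝒳 ⟧ V ψ
  ⟦ 𝒳 ⟧ V (φ ∨f ψ)  = ⟦ 𝒳 ⟧ V φ ∪ᵘ ⟦ 𝒳 ⟧ V ψ
  ⟦ 𝒳 ⟧ V (φ ⇒f ψ)  = ⟦ 𝒳 ⟧ V φ ⇒ᵘ ⟦ 𝒳 ⟧ V ψ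
  ⟦ 𝒳 ⟧ V (♡ l φs)  = γ 𝒳 ⁻¹[ lift (liftingOf Λ l) (X 𝒳) (λ i → ⟦ 𝒳 ⟧ V (φs i)) ]

  Forces : (𝒳 : Dialgebra) → Valuation (X 𝒳) → Poset.Carrier (X 𝒳) → Form → Set
  Forces 𝒳 V x φ = mem (⟦ 𝒳 ⟧ V φ) x

  _⊩_ : Dialgebra → Form → Set₁
  𝒳 ⊩ φ = ∀ (V : Valuation (X 𝒳)) x → Forces 𝒳 V x φ

  data Prop₀ : Form → Set where
    var : ∀ p → Prop₀ (var p)
    ⊤f  : Prop₀ ⊤f
    ⊥f  : Prop₀ ⊥f
    _∧f_ : ∀ {φ ψ} → Prop₀ φ → Prop₀ ψ → Prop₀ (φ ∧f ψ)
    _∨f_ : ∀ {φ ψ} → Prop₀ φ → Prop₀ ψ → Prop₀ (φ ∨f ψ)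

  data Rank1 : Form → Set where
    ⊤f  : Rank1 ⊤f
    ⊥f  : Rank1 ⊥f
    _∧f_ : ∀ {φ ψ} → Rank1 φ → Rank1 ψ → Rank1 (φ ∧f ψ)
    _∨f_ : ∀ {φ ψ} → Rank1 φ → Rank1 ψ → Rank1 (φ ∨f ψ)
    ♡    : ∀ l {φs} → (∀ i → Prop₀ (φs i)) → Rank1 (♡ l φs)

  record Rank1Axiom : Set where
    field
      lhs rhs : Form
      lhs-rank1 : Rank1 lhs
      rhs-rank1 : Rank1 rhs
  open Rank1Axiom public

  record AxiomSet : Set₁ where
    field
      AxIdx : Set
      axiom : AxIdx → Rank1Axiom
  open AxiomSet public

  Sound : Rank1Axiom → Set₁
  Sound a = ∀ (𝒴 : Dialgebra) → 𝒴 ⊩ (lhs a ⇔f rhs a)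

  SoundAxioms : AxiomSet → Set₁
  SoundAxioms Ax = ∀ i → Sound (axiom Ax i)

  -- The functor L: free distributive lattice on ♡̇(a₁,…,aₙ) modulo Ax,
  -- presented as terms with a congruence (a setoid).

  module _ {c ℓ₁ ℓ₂} (A : HeytingAlgebra c ℓ₁ ℓ₂) where
    private module A = HeytingAlgebra A

    data LTerm : Set c where
      gen : (l : Idx Λ) → (Fin (ar Λ l) → A.Carrier) → LTerm
      ⊤L ⊥L : LTerm
      _∧L_ _∨L_ : LTerm → LTerm → LTerm

    -- instances of axioms: letters replaced by elements of A
    eval₀ : (ℕ → A.Carrier) → (φ : Form) → Prop₀ φ → A.Carrier
    eval₀ σ (var p) (var .p) = σ p
    eval₀ σ ⊤f ⊤f = A.⊤
    eval₀ σ ⊥f ⊥f = A.⊥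
    eval₀ σ (φ ∧f ψ) (p ∧f q) = eval₀ σ φ p A.∧ eval₀ σ ψ q
    eval₀ σ (φ ∨f ψ) (p ∨f q) = eval₀ σ φ p A.∨ eval₀ σ ψ q

    inst : (ℕ → A.Carrier) → (φ : Form) → Rank1 φ → LTerm
    inst σ ⊤f ⊤f = ⊤L
    inst σ ⊥f ⊥f = ⊥L
    inst σ (φ ∧f ψ) (p ∧f q) = inst σ φ p ∧L inst σ ψ q
    inst σ (φ ∨f ψ) (p ∨f q) = inst σ φ p ∨L inst σ ψ q
    inst σ (♡ l φs) (♡ .l ps) = gen l (λ i → eval₀ σ (φs i) (ps i))

    data LEq (Ax : AxiomSet) : LTerm → LTerm → Set (c ⊔ˡ ℓ₁) where
      refl  : ∀ {s} → LEq Ax s s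
      sym   : ∀ {s t} → LEq Ax s t → LEq Ax t s
      trans : ∀ {s t u} → LEq Ax s t → LEq Ax t u → LEq Ax s u
      gen-cong : ∀ l {as bs : Fin (ar Λ l) → A.Carrier} →
                 (∀ i → as i A.≈ bs i) → LEq Ax (gen l as) (gen l bs)
      ∧-cong : ∀ {s s' t t'} → LEq Ax s s' → LEq Ax t t' → LEq Ax (s ∧L t) (s' ∧L t')
      ∨-cong : ∀ {s s' t t'} → LEq Ax s s' → LEq Ax t t' → LEq Ax (s ∨L t) (s' ∨L t')
      ∧-assoc : ∀ s t u → LEq Ax ((s ∧L t) ∧L u) (s ∧L (t ∧L u))
      ∨-assoc : ∀ s t u → LEq Ax ((s ∨L t) ∨L u) (s ∨L (t ∨L u))
      ∧-comm : ∀ s t → LEq Ax (s ∧L t) (t ∧L s)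
      ∨-comm : ∀ s t → LEq Ax (s ∨L t) (t ∨L s)
      ∧-absorbs-∨ : ∀ s t → LEq Ax (s ∧L (s ∨L t)) s
      ∨-absorbs-∧ : ∀ s t → LEq Ax (s ∨L (s ∧L t)) s
      ∧-distrib-∨ : ∀ s t u → LEq Ax (s ∧L (t ∨L u)) ((s ∧L t) ∨L (s ∧L u))
      ∧-identity : ∀ s → LEq Ax (s ∧L ⊤L) s
      ∨-identity : ∀ s → LEq Ax (s ∨L ⊥L) s
      axiom-inst : ∀ (i : AxIdx Ax) (σ : ℕ → A.Carrier) →
                   LEq Ax (inst σ (lhs (axiom Ax i)) (lhs-rank1 (axiom Ax i)))
                          (inst σ (rhs (axiom Ax i)) (rhs-rank1 (axiom Ax i)))

  -- the underlying data (A, α) with α : L A → A given on representatives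
  record LStructure (c ℓ₁ ℓ₂ : Level) : Set (lsuc (c ⊔ˡ ℓ₁ ⊔ˡ ℓ₂)) where
    field
      alg : HeytingAlgebra c ℓ₁ ℓ₂
      α   : LTerm alg → HeytingAlgebra.Carrier alg
  open LStructure public

  record LJDialgebra (Ax : AxiomSet) (c ℓ₁ ℓ₂ : Level) : Set (lsuc (c ⊔ˡ ℓ₁ ⊔ˡ ℓ₂)) where
    field
      structure : LStructure c ℓ₁ ℓ₂
    private
      module A = HeytingAlgebra (alg structure)
      α' = α structure
    field
      α-resp : ∀ {s t} → LEq (alg structure) Ax s t → α' s A.≈ α' t
      α-⊤ : α' ⊤L A.≈ A.⊤
      α-⊥ : α' ⊥L A.≈ A.⊥
      α-∧ : ∀ s t → α' (s ∧L t) A.≈ (α' s A.∧ α' t)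
      α-∨ : ∀ s t → α' (s ∨L t) A.≈ (α' s A.∨ α' t)

  module _ {c ℓ₁ ℓ₂} (𝒜 : LStructure c ℓ₁ ℓ₂) where
    private module A = HeytingAlgebra (alg 𝒜)

    evalA : (ℕ → A.Carrier) → Form → A.Carrier
    evalA v (var p)  = v p
    evalA v ⊤f       = A.⊤
    evalA v ⊥f       = A.⊥
    evalA v (φ ∧f ψ) = evalA v φ A.∧ evalA v ψ
    evalA v (φ ∨f ψ) = evalA v φ A.∨ evalA v ψ
    evalA v (φ ⇒f ψ) = evalA v φ A.⇨ evalA v ψ
    evalA v (♡ l φs) = α 𝒜 (gen l (λ i → evalA v (φs i)))

    _⊨_ : Form → Set (c ⊔ˡ ℓ₁)
    _⊨_ φ = ∀ (v : ℕ → A.Carrier) → evalA v φ A.≈ A.⊤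

  _⊨ᴸᴶ_ : ∀ {Ax c ℓ₁ ℓ₂} → LJDialgebra Ax c ℓ₁ ℓ₂ → Form → Set (c ⊔ˡ ℓ₁)
  𝒜 ⊨ᴸᴶ φ = LJDialgebra.structure 𝒜 ⊨ φ

  ρ : (X : Pos₀) → LTerm (UpHA X) → Up (obj T X)
  ρ X (gen l as) = lift (liftingOf Λ l) X as
  ρ X ⊤L = ⊤ᵘ
  ρ X ⊥L = ⊥ᵘ
  ρ X (s ∧L t) = ρ X s ∩ᵘ ρ X t
  ρ X (s ∨L t) = ρ X s ∪ᵘ ρ X t

  _⁺ : Dialgebra → LStructure (lsuc 0ℓ) 0ℓ 0ℓ
  𝒳 ⁺ = record { alg = UpHA (X 𝒳) ; α = λ t → γ 𝒳 ⁻¹[ ρ (X 𝒳) t ] }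

{-# OPTIONS --safe #-}
module Submission where

-- The complex algebra 𝒳⁺ interprets each connective by the corresponding
-- operation on upsets and ♡^λ by γ⁻¹ ∘ λ, just as the Kripke semantics does,
-- so under a valuation V the value of φ in 𝒳⁺ is the truth set ⟦φ⟧_V (up to
-- extensional equality of upsets); and an upset is the top element of
-- Up(X,≤) iff it contains every point.

open import Defs
open import Data.Fin using (Fin)
open import Data.Product using (_,_; proj₂)
open import Data.Unit using () renaming (tt to ⋆)
open import Function using (_∘_)
open import Function.Bundles using (_⇔_; mk⇔; module Equivalence)
open import Relation.Binary.Lattice.Bundles using (HeytingAlgebra)
import Relation.Binary.Lattice.Properties.HeytingAlgebra as HeytingProperties
import Relation.Binary.Lattice.Properties.JoinSemilattice as JoinProperties
import Relation.Binary.Lattice.Properties.MeetSemilattice as MeetProperties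

-- _≐_ only compares membership predicates, so Agda cannot infer the upsets
-- (which also carry upward closure) from a proof of a ≐ b; hence the explicit
-- implicit arguments below.
module _ {X : Pos₀} where
  private module UpX = HeytingAlgebra (UpHA X)

  ≐-refl : {a : Up X} → a ≐ a
  ≐-refl {a} = UpX.Eq.refl {a}

  ∩ᵘ-cong : {a a′ b b′ : Up X} → a ≐ a′ → b ≐ b′ → (a ∩ᵘ b) ≐ (a′ ∩ᵘ b′)
  ∩ᵘ-cong {a} {a′} {b} {b′} = MeetProperties.∧-cong UpX.meetSemilattice {a} {a′} {b} {b′}

  ∪ᵘ-cong : {a a′ b b′ : Up X} → a ≐ a′ → b ≐ b′ → (a ∪ᵘ b) ≐ (a′ ∪ᵘ b′)
  ∪ᵘ-cong {a} {a′} {b} {b′} = JoinProperties.∨-cong UpX.joinSemilattice {a} {a′} {b} {b′}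

  ⇒ᵘ-cong : {a a′ b b′ : Up X} → a ≐ a′ → b ≐ b′ → (a ⇒ᵘ b) ≐ (a′ ⇒ᵘ b′)
  ⇒ᵘ-cong {a} {a′} {b} {b′} = HeytingProperties.⇨-cong (UpHA X) {a} {a′} {b} {b′}

  everywhere⇔≐⊤ᵘ : {a b : Up X} → a ≐ b → (∀ x → mem a x) ⇔ (b ≐ ⊤ᵘ)
  everywhere⇔≐⊤ᵘ (a⊆b , b⊆a) = mk⇔
    (λ a-everywhere → (λ _ _ → ⋆) , (λ x _ → a⊆b x (a-everywhere x)))
    (λ b≐⊤ x → b⊆a x (proj₂ b≐⊤ x ⋆))

⁻¹[]-cong : {X Y : Pos₀} (f : Mono X Y) {a b : Up Y} → a ≐ b → (f ⁻¹[ a ]) ≐ (f ⁻¹[ b ])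
⁻¹[]-cong f (a⊆b , b⊆a) = (λ x → a⊆b (app f x)) , (λ x → b⊆a (app f x))

module _ {T : KripToPos} (Λ : Liftings T) where
  open Language Λ

  module _ (𝒳 : Dialgebra) (V : Valuation (X 𝒳)) where
    private
      ⟦_⟧ᵛ ⟦_⟧⁺ : Form → Up (X 𝒳)
      ⟦_⟧ᵛ = ⟦ 𝒳 ⟧ V
      ⟦_⟧⁺ = evalA (𝒳 ⁺) V

    ⟦⟧≐evalA⁺ : (φ : Form) → ⟦ φ ⟧ᵛ ≐ ⟦ φ ⟧⁺
    ⟦⟧≐evalA⁺ (var p)  = ≐-refl {a = V p}
    ⟦⟧≐evalA⁺ ⊤f       = ≐-refl {a = ⊤ᵘ {X 𝒳}}
    ⟦⟧≐evalA⁺ ⊥f       = ≐-refl {a = ⊥ᵘ {X 𝒳}}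
    ⟦⟧≐evalA⁺ (φ ∧f ψ) =
      ∩ᵘ-cong {a = ⟦ φ ⟧ᵛ} {⟦ φ ⟧⁺} {⟦ ψ ⟧ᵛ} {⟦ ψ ⟧⁺} (⟦⟧≐evalA⁺ φ) (⟦⟧≐evalA⁺ ψ)
    ⟦⟧≐evalA⁺ (φ ∨f ψ) =
      ∪ᵘ-cong {a = ⟦ φ ⟧ᵛ} {⟦ φ ⟧⁺} {⟦ ψ ⟧ᵛ} {⟦ ψ ⟧⁺} (⟦⟧≐evalA⁺ φ) (⟦⟧≐evalA⁺ ψ)
    ⟦⟧≐evalA⁺ (φ ⇒f ψ) =
      ⇒ᵘ-cong {a = ⟦ φ ⟧ᵛ} {⟦ φ ⟧⁺} {⟦ ψ ⟧ᵛ} {⟦ ψ ⟧⁺} (⟦⟧≐evalA⁺ φ) (⟦⟧≐evalA⁺ ψ)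
    ⟦⟧≐evalA⁺ (♡ l φs) =
      ⁻¹[]-cong (γ 𝒳) {a = liftₗ (⟦_⟧ᵛ ∘ φs)} {b = liftₗ (⟦_⟧⁺ ∘ φs)}
        (lift-cong (liftingOf Λ l) (X 𝒳) _ _ (λ i → ⟦⟧≐evalA⁺ (φs i)))
      where
      liftₗ : (Fin (ar Λ l) → Up (X 𝒳)) → Up (obj T (X 𝒳))
      liftₗ = lift (liftingOf Λ l) (X 𝒳)

    everywhere⇔evalA⁺≐⊤ᵘ : (φ : Form) → (∀ x → Forces 𝒳 V x φ) ⇔ (evalA (𝒳 ⁺) V φ ≐ ⊤ᵘ)
    everywhere⇔evalA⁺≐⊤ᵘ φ = everywhere⇔≐⊤ᵘ {a = ⟦ φ ⟧ᵛ} {b = ⟦ φ ⟧⁺} (⟦⟧≐evalA⁺ φ)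

proposition3p22 : (T : KripToPos) (Λ : Liftings T) →
    let open Language Λ in
    (Ax : AxiomSet) → SoundAxioms Ax →
    (𝒳 : Dialgebra) (φ : Form) →
    (𝒳 ⊩ φ) ⇔ ((𝒳 ⁺) ⊨ φ)
proposition3p22 T Λ _ _ 𝒳 φ = mk⇔
  (λ 𝒳⊩φ V → Equivalence.to (everywhere⇔evalA⁺≐⊤ᵘ Λ 𝒳 V φ) (𝒳⊩φ V))
  (λ 𝒳⁺⊨φ V → Equivalence.from (everywhere⇔evalA⁺≐⊤ᵘ Λ 𝒳 V φ) (𝒳⁺⊨φ V))
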